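{- Let $n\ge 2$ and let $a,b$ be positive integers with $a,b\le 2^n$. If $|a-b|\le 2^{\max\{v_2(a),v_2(b)\}}$, then $(a,b)$ is fit in $Q_{n+1}$.
   Context: $v_2(a)$ denotes the largest $j$ such that $2^j$ divides $a$. $Q_N=\{0,1\}^N$ is the hypercube graph (binary strings $x_0\ldots x_{N-1}$, adjacent iff they differ in exactly one digit), with automorphism group $\mathrm{Aut}(Q_N)$. Strings are identified with integers $\sum_i x_i2^{N-1-i}$; for $0\le k\le 2^N$, $I_k\subseteq Q_N$ is the set of strings with value $<k$. A pair of positive integers $(a,b)$ with $a+b\le 2^N$ is fit in $Q_N$ if there exist $g_1,g_2\in\mathrm{Aut}(Q_N)$ with $g_1(I_a)\cup g_2(I_b)=I_{a+b}$, and unfit otherwise. -}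

module Defs where

open import Data.Nat using (ℕ; zero; suc; _+_; _*_; _^_; _≤_; _<_)
open import Data.Nat.Divisibility using (_∣_)
open import Data.Bool using (Bool; true; false; if_then_else_)
open import Data.Vec using (Vec; []; _∷_)
open import Data.Product using (Σ; _×_; ∃-syntax)
open import Data.Sum using (_⊎_)
open import Relation.Binary.PropositionalEquality using (_≡_)
open import Function.Definitions using (Bijective)
open import Function.Bundles using (_⇔_)

IsV2 : ℕ → ℕ → Set
IsV2 a j = (2 ^ j ∣ a) × (∀ k → 2 ^ k ∣ a → k ≤ j)

Q : ℕ → Set
Q N = Vec Bool N

bit : Bool → ℕ
bit true  = 1
bit false = 0

val : ∀ {N} → Q N → ℕ
val []            = 0
val {suc n} (x ∷ xs) = bit x * 2 ^ n + val xs

hamming : ∀ {N} → Q N → Q N → ℕ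
hamming []       []       = 0
hamming (x ∷ xs) (y ∷ ys) = (if x then (if y then 0 else 1) else (if y then 1 else 0)) + hamming xs ys

Adj : ∀ {N} → Q N → Q N → Set
Adj x y = hamming x y ≡ 1

IsAut : ∀ N → (Q N → Q N) → Set
IsAut N f = Bijective _≡_ _≡_ f × (∀ x y → Adj x y ⇔ Adj (f x) (f y))

InI : ∀ {N} → ℕ → Q N → Set
InI k x = val x < k

Fit : ℕ → ℕ → ℕ → Set
Fit N a b =
  ∃[ g₁ ] ∃[ g₂ ] (IsAut N g₁ × IsAut N g₂ ×
    (∀ (y : Q N) → InI (a + b) y ⇔
       ((∃[ x ] (InI a x × g₁ x ≡ y)) ⊎ (∃[ x ] (InI b x × g₂ x ≡ y)))))

{-# OPTIONS --safe #-}
-- By symmetry let s = v₂(a) ≥ v₂(b), so a = p·2^s, |a − b| ≤ 2^s, and write n = k + s.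
-- Moving the leading bit of a string of Q_{n+1} down to position k is an automorphism
-- sending a string with leading bit c, next k bits of value H and last s bits of value L
-- to the number (2H + c)·2^s + L. So it spreads the initial segment I_m of the lower half
-- Q_n over the even-numbered blocks of size 2^s, and composed with the flip of the leading
-- bit it spreads I_m over the odd-numbered blocks. As a and b differ by at most one block
-- and one of them is a multiple of 2^s, the even blocks filled by one and the odd blocks
-- filled by the other tile exactly I_{a+b}.
module Submission where

open import Defs
open import Data.Nat using (ℕ; zero; suc; _+_; _*_; _∸_; _^_; _≤_; _<_; _⊔_; ∣_-_∣; z≤n; >-nonZero)
open import Data.Nat.Properties
open import Data.Nat.Divisibility using (_∣_; divides; ∣⇒≤)
open import Data.Nat.Tactic.RingSolver using (solve-∀)
open import Data.Bool using (true; false; not)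
open import Data.Bool.Properties using (not-involutive)
open import Data.Vec using ([]; _∷_; _++_; splitAt)
open import Data.Product using (_×_; _,_; ∃-syntax)
open import Data.Product.Function.NonDependent.Propositional using (_×-⇔_)
open import Data.Sum using (_⊎_; inj₁; inj₂; [_,_]; swap)
open import Data.Sum.Function.Propositional using (_⊎-⇔_)
open import Data.Empty using (⊥-elim)
open import Level using (0ℓ)
open import Relation.Nullary using (¬_; contradiction; yes; no)
open import Relation.Binary.Definitions using (tri<; tri≈; tri>)
open import Relation.Binary.PropositionalEquality
  using (_≡_; refl; sym; trans; cong; cong₂; subst; subst₂; module ≡-Reasoning)
open import Function using (id; _∘_)
open import Function.Bundles using (_⇔_; mk⇔; _↔_; mk↔ₛ′; Inverse; Bijection)
open import Function.Properties.Equivalence using (⇔-setoid)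
  renaming (refl to ⇔-refl; sym to ⇔-sym; trans to ⇔-trans)
open import Relation.Binary.Bundles using (Setoid)
open Setoid (⇔-setoid 0ℓ) using () renaming (reflexive to ≡⇒⇔)
import Relation.Binary.Reasoning.Setoid as SetoidReasoning
open import Function.Properties.Inverse using (↔⇒⤖)
open import Function.Construct.Composition using (_↔-∘_)

*+≤* : ∀ {q H D R} → q < H → R ≤ D → q * D + R ≤ H * D
*+≤* {q} {H} {D} {R} q<H R≤D = begin
  q * D + R ≤⟨ +-monoʳ-≤ (q * D) R≤D ⟩
  q * D + D ≡⟨ +-comm (q * D) D ⟩
  suc q * D ≤⟨ *-monoˡ-≤ D q<H ⟩
  H * D     ∎
  where open ≤-Reasoning

*+<* : ∀ {H q D L} → H < q → L < D → H * D + L < q * D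
*+<* {H} {q} {D} H<q L<D = <-≤-trans (+-monoʳ-< (H * D) L<D) (*+≤* H<q ≤-refl)

*+<*+⇔lex : ∀ {H L q R D} → L < D → R ≤ D →
            (H * D + L < q * D + R) ⇔ (H < q ⊎ H ≡ q × L < R)
*+<*+⇔lex {H} {L} {q} {R} {D} L<D R≤D = mk⇔ to from
  where
  to : H * D + L < q * D + R → H < q ⊎ H ≡ q × L < R
  to lt with <-cmp H q
  ... | tri< H<q _ _ = inj₁ H<q
  ... | tri≈ _ refl _ = inj₂ (refl , +-cancelˡ-< (H * D) L R lt)
  ... | tri> _ _ q<H = contradiction lt (≤⇒≯ (≤-trans (*+≤* q<H R≤D) (m≤m+n (H * D) L)))
  from : H < q ⊎ H ≡ q × L < R → H * D + L < q * D + R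
  from (inj₁ H<q)         = <-≤-trans (*+<* H<q L<D) (m≤m+n (q * D) R)
  from (inj₂ (refl , L<R)) = +-monoʳ-< (H * D) L<R

*+<*+-cong : ∀ {H q D L R D′ L′ R′} → L < D → R ≤ D → L′ < D′ → R′ ≤ D′ →
             (L < R ⇔ L′ < R′) → (H * D + L < q * D + R) ⇔ (H * D′ + L′ < q * D′ + R′)
*+<*+-cong {H} {q} L<D R≤D L′<D′ R′≤D′ offsets =
  ⇔-trans (*+<*+⇔lex {H} {q = q} L<D R≤D)
    (⇔-trans (⇔-refl ⊎-⇔ (⇔-refl ×-⇔ offsets)) (⇔-sym (*+<*+⇔lex L′<D′ R′≤D′)))

-- The first q·D + r₀ places of the even blocks and the first q·D + r₁ places of the odd
-- blocks (all of size D) tile an initial segment when the last odd block is empty or the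
-- last even block is full.
data Staggered (D : ℕ) : ℕ → ℕ → Set where
  oddEmpty : ∀ {r} → r ≤ D → Staggered D r 0
  evenFull : ∀ {r} → r ≤ D → Staggered D D r

staggered-even : ∀ {D r₀ r₁ L} → Staggered D r₀ r₁ → L < D → (L < r₀ + r₁ ⇔ L < r₀)
staggered-even {r₀ = r} {L = L} (oddEmpty _) _ =
  mk⇔ (subst (L <_) (+-identityʳ r)) (subst (L <_) (sym (+-identityʳ r)))
staggered-even {D} {r₁ = r} (evenFull _) L<D = mk⇔ (λ _ → L<D) (λ _ → <-≤-trans L<D (m≤m+n D r))

staggered-odd : ∀ {D r₀ r₁ L} → Staggered D r₀ r₁ → L < D → (D + L < r₀ + r₁ ⇔ L < r₁)
staggered-odd {D} {r₀ = r} {L = L} (oddEmpty r≤D) _ =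
  mk⇔ (λ lt → contradiction (≤-trans (≤-reflexive (+-identityʳ r)) (≤-trans r≤D (m≤m+n D L)))
                            (<⇒≱ lt))
      (λ ())
staggered-odd {D} {r₁ = r} {L = L} (evenFull _) _ = mk⇔ (+-cancelˡ-< D L r) (+-monoʳ-< D)

staggered-even≤ : ∀ {D r₀ r₁} → Staggered D r₀ r₁ → r₀ ≤ D
staggered-even≤ (oddEmpty r≤D) = r≤D
staggered-even≤ (evenFull _)   = ≤-refl

staggered-odd≤ : ∀ {D r₀ r₁} → Staggered D r₀ r₁ → r₁ ≤ D
staggered-odd≤ (oddEmpty _)   = z≤n
staggered-odd≤ (evenFull r≤D) = r≤D

val<2^ : ∀ {n} (x : Q n) → val x < 2 ^ n
val<2^ [] = ≤-refl
val<2^ {suc n} (c ∷ x) = begin-strict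
  bit c * 2 ^ n + val x <⟨ +-mono-≤-< (*-monoˡ-≤ (2 ^ n) (bit≤1 c)) (val<2^ x) ⟩
  1 * 2 ^ n + 2 ^ n     ≡⟨ +-comm (1 * 2 ^ n) (2 ^ n) ⟩
  2 * 2 ^ n             ∎
  where
  open ≤-Reasoning
  bit≤1 : ∀ c → bit c ≤ 1
  bit≤1 true  = ≤-refl
  bit≤1 false = z≤n

val-++ : ∀ {k s} (u : Q k) (w : Q s) → val (u ++ w) ≡ val u * 2 ^ s + val w
val-++ [] w = refl
val-++ {suc k} {s} (c ∷ u) w = begin
  bit c * 2 ^ (k + s) + val (u ++ w)
    ≡⟨ cong₂ _+_ (cong (bit c *_) (^-distribˡ-+-* 2 k s)) (val-++ u w) ⟩
  bit c * (2 ^ k * 2 ^ s) + (val u * 2 ^ s + val w)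
    ≡⟨ regroup (bit c) (2 ^ k) (2 ^ s) (val u) (val w) ⟩
  (bit c * 2 ^ k + val u) * 2 ^ s + val w
    ∎
  where
  open ≡-Reasoning
  regroup : ∀ b P D H L → b * (P * D) + (H * D + L) ≡ (b * P + H) * D + L
  regroup = solve-∀

true∷∉I : ∀ {n m} (x : Q n) → m ≤ 2 ^ n → ¬ InI m (true ∷ x)
true∷∉I {n} x m≤2^n = ≤⇒≯ (≤-trans m≤2^n (≤-trans (m≤m+n (2 ^ n) 0) (m≤m+n (1 * 2 ^ n) (val x))))

sink : ∀ k {s} → Q (suc (k + s)) → Q (suc (k + s))
sink zero    x           = x
sink (suc k) (c ∷ d ∷ x) = d ∷ sink k (c ∷ x)

float : ∀ k {s} → Q (suc (k + s)) → Q (suc (k + s))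
float zero    y       = y
float (suc k) (d ∷ y) with float k y
... | c ∷ x = c ∷ d ∷ x

float-sink : ∀ k {s} (x : Q (suc (k + s))) → float k (sink k x) ≡ x
float-sink zero    x           = refl
float-sink (suc k) (c ∷ d ∷ x) rewrite float-sink k (c ∷ x) = refl

sink-float : ∀ k {s} (y : Q (suc (k + s))) → sink k (float k y) ≡ y
sink-float zero    y       = refl
sink-float (suc k) (d ∷ y) with float k y | sink-float k y
... | c ∷ x | sink-float-y = cong (d ∷_) sink-float-y

hamming-∷ : ∀ {n} c c′ (x y : Q n) →
            hamming (c ∷ x) (c′ ∷ y) ≡ hamming (c ∷ []) (c′ ∷ []) + hamming x y
hamming-∷ c c′ x y = cong (_+ hamming x y) (sym (+-identityʳ _))

hamming-sink : ∀ k {s} (x y : Q (suc (k + s))) → hamming (sink k x) (sink k y) ≡ hamming x y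
hamming-sink zero    x           y             = refl
hamming-sink (suc k) (c ∷ d ∷ x) (c′ ∷ d′ ∷ y) = begin
  hamming (d ∷ sink k (c ∷ x)) (d′ ∷ sink k (c′ ∷ y))
    ≡⟨ hamming-∷ d d′ (sink k (c ∷ x)) (sink k (c′ ∷ y)) ⟩
  δd + hamming (sink k (c ∷ x)) (sink k (c′ ∷ y))
    ≡⟨ cong (δd +_) (trans (hamming-sink k (c ∷ x) (c′ ∷ y)) (hamming-∷ c c′ x y)) ⟩
  δd + (δc + hamming x y)
    ≡⟨ exchange δd δc (hamming x y) ⟩
  δc + (δd + hamming x y)
    ≡⟨ cong (δc +_) (hamming-∷ d d′ x y) ⟨
  δc + hamming (d ∷ x) (d′ ∷ y)
    ≡⟨ hamming-∷ c c′ (d ∷ x) (d′ ∷ y) ⟨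
  hamming (c ∷ d ∷ x) (c′ ∷ d′ ∷ y)
    ∎
  where
  open ≡-Reasoning
  δc = hamming (c ∷ []) (c′ ∷ [])
  δd = hamming (d ∷ []) (d′ ∷ [])
  exchange : ∀ a b c → a + (b + c) ≡ b + (a + c)
  exchange = solve-∀

val-sink : ∀ {k s} c (u : Q k) (w : Q s) → val (sink k (c ∷ u ++ w)) ≡ (2 * val u + bit c) * 2 ^ s + val w
val-sink c [] w = refl
val-sink {suc k} {s} c (d ∷ u) w = begin
  bit d * 2 ^ suc (k + s) + val (sink k (c ∷ u ++ w))
    ≡⟨ cong₂ _+_ (cong (λ e → bit d * (2 * e)) (^-distribˡ-+-* 2 k s)) (val-sink c u w) ⟩
  bit d * (2 * (2 ^ k * 2 ^ s)) + ((2 * val u + bit c) * 2 ^ s + val w)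
    ≡⟨ regroup (bit d) (2 ^ k) (2 ^ s) (val u) (bit c) (val w) ⟩
  (2 * (bit d * 2 ^ k + val u) + bit c) * 2 ^ s + val w
    ∎
  where
  open ≡-Reasoning
  regroup : ∀ b P D H c L → b * (2 * (P * D)) + ((2 * H + c) * D + L) ≡ (2 * (b * P + H) + c) * D + L
  regroup = solve-∀

flipHead : ∀ {n} → Q (suc n) → Q (suc n)
flipHead (c ∷ x) = not c ∷ x

flipHead-involutive : ∀ {n} (x : Q (suc n)) → flipHead (flipHead x) ≡ x
flipHead-involutive (c ∷ x) = cong (_∷ x) (not-involutive c)

hamming-flipHead : ∀ {n} (x y : Q (suc n)) → hamming (flipHead x) (flipHead y) ≡ hamming x y
hamming-flipHead (true  ∷ x) (true  ∷ y) = refl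
hamming-flipHead (true  ∷ x) (false ∷ y) = refl
hamming-flipHead (false ∷ x) (true  ∷ y) = refl
hamming-flipHead (false ∷ x) (false ∷ y) = refl

sink↔ : ∀ k {s} → Q (suc (k + s)) ↔ Q (suc (k + s))
sink↔ k = mk↔ₛ′ (sink k) (float k) (sink-float k) (float-sink k)

flipHead↔ : ∀ {n} → Q (suc n) ↔ Q (suc n)
flipHead↔ = mk↔ₛ′ flipHead flipHead flipHead-involutive flipHead-involutive

isometry⇒IsAut : ∀ {N} (σ : Q N ↔ Q N) →
                 (∀ x y → hamming (Inverse.to σ x) (Inverse.to σ y) ≡ hamming x y) → IsAut N (Inverse.to σ)
isometry⇒IsAut σ isometry =
  Bijection.bijective (↔⇒⤖ σ) , λ x y → mk⇔ (trans (isometry x y)) (trans (sym (isometry x y)))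

image⇔preimage : ∀ {A : Set} (σ : A ↔ A) (P : A → Set) y →
                 (∃[ x ] (P x × Inverse.to σ x ≡ y)) ⇔ P (Inverse.from σ y)
image⇔preimage σ P y = mk⇔ (λ { (x , Px , refl) → subst P (sym (strictlyInverseʳ x)) Px })
                           (λ P[from-y] → from y , P[from-y] , strictlyInverseˡ y)
  where open Inverse σ

Fit-sym : ∀ {N a b} → Fit N a b → Fit N b a
Fit-sym {N} {a} {b} (g₁ , g₂ , g₁-aut , g₂-aut , union) =
  g₂ , g₁ , g₂-aut , g₁-aut , λ y →
    ⇔-trans (≡⇒⇔ (cong (λ m → InI m y) (+-comm b a))) (⇔-trans (union y) (mk⇔ swap swap))

module _ (k : ℕ) {s q r₀ r₁ : ℕ} (staggered : Staggered (2 ^ s) r₀ r₁)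
         (m₀≤2^n : q * 2 ^ s + r₀ ≤ 2 ^ (k + s)) (m₁≤2^n : q * 2 ^ s + r₁ ≤ 2 ^ (k + s)) where

  private
    D  = 2 ^ s
    m₀ = q * D + r₀
    m₁ = q * D + r₁

    sum-form : m₀ + m₁ ≡ q * (D + D) + (r₀ + r₁)
    sum-form = regroup q D r₀ r₁
      where
      regroup : ∀ q D r₀ r₁ → (q * D + r₀) + (q * D + r₁) ≡ q * (D + D) + (r₀ + r₁)
      regroup = solve-∀

    r₀+r₁≤D+D : r₀ + r₁ ≤ D + D
    r₀+r₁≤D+D = +-mono-≤ (staggered-even≤ staggered) (staggered-odd≤ staggered)

  even-block : ∀ (u : Q k) (w : Q s) → InI (m₀ + m₁) (sink k (false ∷ u ++ w)) ⇔ InI m₀ (false ∷ u ++ w)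
  even-block u w = begin
    val (sink k (false ∷ u ++ w)) < m₀ + m₁
      ≡⟨ cong₂ _<_ (trans (val-sink false u w) (regroup H D L)) sum-form ⟩
    H * (D + D) + L < q * (D + D) + (r₀ + r₁)
      ≈⟨ *+<*+-cong {H} {q} (<-≤-trans L<D (m≤m+n D D)) r₀+r₁≤D+D L<D (staggered-even≤ staggered)
                    (staggered-even staggered L<D) ⟩
    H * D + L < q * D + r₀
      ≡⟨ cong (_< m₀) (val-++ u w) ⟨
    val (u ++ w) < m₀
      ∎
    where
    open SetoidReasoning (⇔-setoid 0ℓ)
    H = val u
    L = val w
    L<D = val<2^ w
    regroup : ∀ H D L → (2 * H + 0) * D + L ≡ H * (D + D) + L
    regroup = solve-∀

  odd-block : ∀ (u : Q k) (w : Q s) → InI (m₀ + m₁) (sink k (true ∷ u ++ w)) ⇔ InI m₁ (false ∷ u ++ w)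
  odd-block u w = begin
    val (sink k (true ∷ u ++ w)) < m₀ + m₁
      ≡⟨ cong₂ _<_ (trans (val-sink true u w) (regroup H D L)) sum-form ⟩
    H * (D + D) + (D + L) < q * (D + D) + (r₀ + r₁)
      ≈⟨ *+<*+-cong {H} {q} (+-monoʳ-< D L<D) r₀+r₁≤D+D L<D (staggered-odd≤ staggered)
                    (staggered-odd staggered L<D) ⟩
    H * D + L < q * D + r₁
      ≡⟨ cong (_< m₁) (val-++ u w) ⟨
    val (u ++ w) < m₁
      ∎
    where
    open SetoidReasoning (⇔-setoid 0ℓ)
    H = val u
    L = val w
    L<D = val<2^ w
    regroup : ∀ H D L → (2 * H + 1) * D + L ≡ H * (D + D) + (D + L)
    regroup = solve-∀

  interleave : ∀ (z : Q (suc (k + s))) → InI (m₀ + m₁) (sink k z) ⇔ (InI m₀ z ⊎ InI m₁ (flipHead z))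
  interleave (c ∷ x) with splitAt k x
  interleave (false ∷ x) | u , w , refl =
    ⇔-trans (even-block u w) (mk⇔ inj₁ [ id , ⊥-elim ∘ true∷∉I (u ++ w) m₁≤2^n ])
  interleave (true ∷ x)  | u , w , refl =
    ⇔-trans (odd-block u w) (mk⇔ inj₂ [ ⊥-elim ∘ true∷∉I (u ++ w) m₀≤2^n , id ])

  fit-interleaved : Fit (suc (k + s)) m₀ m₁
  fit-interleaved =
    Inverse.to g₀ , Inverse.to g₁ ,
    isometry⇒IsAut g₀ (hamming-sink k) ,
    isometry⇒IsAut g₁ (λ x y → trans (hamming-sink k (flipHead x) (flipHead y)) (hamming-flipHead x y)) ,
    λ y → begin
      InI (m₀ + m₁) y
        ≡⟨ cong (InI (m₀ + m₁)) (sink-float k y) ⟨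
      InI (m₀ + m₁) (sink k (float k y))
        ≈⟨ interleave (float k y) ⟩
      (InI m₀ (float k y) ⊎ InI m₁ (flipHead (float k y)))
        ≈⟨ image⇔preimage g₀ (InI m₀) y ⊎-⇔ image⇔preimage g₁ (InI m₁) y ⟨
      ((∃[ x ] (InI m₀ x × Inverse.to g₀ x ≡ y)) ⊎ (∃[ x ] (InI m₁ x × Inverse.to g₁ x ≡ y)))
        ∎
    where
    open SetoidReasoning (⇔-setoid 0ℓ)
    g₀ = sink↔ k
    g₁ = sink↔ k ↔-∘ flipHead↔

fit-above-multiple : ∀ k {s} p t → t ≤ 2 ^ s → p * 2 ^ s + t ≤ 2 ^ (k + s) →
                     Fit (suc (k + s)) (p * 2 ^ s) (p * 2 ^ s + t)
fit-above-multiple k {s} p t t≤D b≤2^n =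
  Fit-sym (subst (Fit (suc (k + s)) (p * 2 ^ s + t)) (+-identityʳ (p * 2 ^ s))
    (fit-interleaved k {s} {p} (oddEmpty t≤D) b≤2^n a≤2^n))
  where
  a≤2^n : p * 2 ^ s + 0 ≤ 2 ^ (k + s)
  a≤2^n = ≤-trans (+-monoʳ-≤ (p * 2 ^ s) z≤n) b≤2^n

fit-below-multiple : ∀ k {s} q r → r ≤ 2 ^ s → suc q * 2 ^ s ≤ 2 ^ (k + s) →
                     Fit (suc (k + s)) (suc q * 2 ^ s) (q * 2 ^ s + r)
fit-below-multiple k {s} q r r≤D a≤2^n =
  subst (λ a → Fit (suc (k + s)) a (q * 2 ^ s + r)) (+-comm (q * 2 ^ s) (2 ^ s))
    (fit-interleaved k {s} {q} (evenFull r≤D) qD+D≤2^n b≤2^n)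
  where
  qD+D≤2^n : q * 2 ^ s + 2 ^ s ≤ 2 ^ (k + s)
  qD+D≤2^n = ≤-trans (≤-reflexive (+-comm (q * 2 ^ s) (2 ^ s))) a≤2^n
  b≤2^n : q * 2 ^ s + r ≤ 2 ^ (k + s)
  b≤2^n = ≤-trans (+-monoʳ-≤ (q * 2 ^ s) r≤D) qD+D≤2^n

prev-multiple≤ : ∀ {D q b} → b ≤ suc q * D → ∣ suc q * D - b ∣ ≤ D → q * D ≤ b
prev-multiple≤ {D} {q} {b} b≤a close = +-cancelˡ-≤ D (q * D) b (begin
  D + q * D           ≡⟨ m∸n+n≡m b≤a ⟨
  (D + q * D) ∸ b + b ≤⟨ +-monoˡ-≤ b (subst (_≤ D) (m≤n⇒∣n-m∣≡n∸m b≤a) close) ⟩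
  D + b               ∎)
  where open ≤-Reasoning

fit-near-multiple : ∀ k {s} p {b} → p * 2 ^ s ≤ 2 ^ (k + s) → b ≤ 2 ^ (k + s) →
                    ∣ p * 2 ^ s - b ∣ ≤ 2 ^ s → Fit (suc (k + s)) (p * 2 ^ s) b
fit-near-multiple k {s} p {b} a≤2^n b≤2^n close with p * 2 ^ s ≤? b
... | yes a≤b with m≤n⇒∃[o]m+o≡n a≤b
...   | t , refl = fit-above-multiple k p t (subst (_≤ 2 ^ s) (∣m-m+n∣≡n (p * 2 ^ s) t) close) b≤2^n
fit-near-multiple k {s} zero    a≤2^n b≤2^n close | no a≰b = contradiction z≤n a≰b
fit-near-multiple k {s} (suc q) a≤2^n b≤2^n close | no a≰b
  with m≤n⇒∃[o]m+o≡n (prev-multiple≤ {2 ^ s} {q} (<⇒≤ (≰⇒> a≰b)) close)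
... | r , refl = fit-below-multiple k q r (<⇒≤ r<D) a≤2^n
  where
  r<D : r < 2 ^ s
  r<D = +-cancelˡ-< (q * 2 ^ s) r (2 ^ s) (subst (q * 2 ^ s + r <_) (+-comm (2 ^ s) (q * 2 ^ s)) (≰⇒> a≰b))

^-cancelˡ-≤ : ∀ m {s n} → 1 < m → m ^ s ≤ m ^ n → s ≤ n
^-cancelˡ-≤ m 1<m m^s≤m^n = ≮⇒≥ (λ n<s → <⇒≱ (^-monoʳ-< m 1<m n<s) m^s≤m^n)

fit-of-divisor : ∀ {n a b} s → 0 < a → a ≤ 2 ^ n → b ≤ 2 ^ n →
                 2 ^ s ∣ a → ∣ a - b ∣ ≤ 2 ^ s → Fit (suc n) a b
fit-of-divisor {n} s 0<a a≤2^n b≤2^n 2^s∣a@(divides p refl) close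
  with n ∸ s | m∸n+n≡m {n} {s} s≤n
  where
  s≤n : s ≤ n
  s≤n = ^-cancelˡ-≤ 2 ≤-refl (≤-trans (∣⇒≤ ⦃ >-nonZero 0<a ⦄ 2^s∣a) a≤2^n)
... | k | refl = fit-near-multiple k p a≤2^n b≤2^n close

mainTheorem8 : ∀ (n a b : ℕ) → 2 ≤ n → 1 ≤ a → 1 ≤ b → a ≤ 2 ^ n → b ≤ 2 ^ n →
    ∀ (va vb : ℕ) → IsV2 a va → IsV2 b vb →
    ∣ a - b ∣ ≤ 2 ^ (va ⊔ vb) →
    Fit (suc n) a b
mainTheorem8 n a b _ 0<a 0<b a≤2^n b≤2^n va vb (2^va∣a , _) (2^vb∣b , _) close with ≤-total vb va
... | inj₁ vb≤va =
  fit-of-divisor va 0<a a≤2^n b≤2^n 2^va∣a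
    (subst (λ v → ∣ a - b ∣ ≤ 2 ^ v) (m≥n⇒m⊔n≡m vb≤va) close)
... | inj₂ va≤vb =
  Fit-sym (fit-of-divisor vb 0<b b≤2^n a≤2^n 2^vb∣b
    (subst₂ (λ d v → d ≤ 2 ^ v) (∣-∣-comm a b) (m≤n⇒m⊔n≡n va≤vb) close))
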